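{- For $5\leq t\leq 8$ we have $rx_3(K_{2,t})=4$, and $rx_3(K_{2,t})\geq 5$ for every $t\geq 9$.
   Context: All graphs are simple, finite and undirected. In an edge-colored graph $G$ (adjacent edges may share colors), a tree is a rainbow tree if no two of its edges have the same color; for $S\subseteq V(G)$, an $S$-tree is a tree in $G$ containing all vertices of $S$. A $3$-rainbow coloring of $G$ is an edge coloring such that for every set $S$ of $3$ vertices there is a rainbow $S$-tree. The $3$-rainbow index $rx_3(G)$ is the minimum number of colors in a $3$-rainbow coloring of $G$. $K_{2,t}$ is the complete bipartite graph with parts of sizes $2$ and $t$. -}

module Defs where

open import Level using (Level; 0ℓ) renaming (suc to lsuc)
open import Data.Nat using (ℕ; zero; suc; _+_; _<_; _≤_)
open import Data.Fin using (Fin; toℕ; inject₁; fromℕ) renaming (zero to fzero; suc to fsuc)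
open import Data.Product using (Σ; _×_; _,_; ∃)
open import Data.Sum using (_⊎_; inj₁; inj₂)
open import Relation.Nullary using (¬_)
open import Relation.Binary.PropositionalEquality using (_≡_)

record Graph : Set₁ where
  field
    n      : ℕ
    Adj    : Fin n → Fin n → Set
    sym    : ∀ {u v} → Adj u v → Adj v u
    irrefl : ∀ {u} → ¬ Adj u u

module _ (G : Graph) where
  open Graph G

  record EdgeColoring (k : ℕ) : Set where
    field
      col     : Fin n → Fin n → Fin k
      col-sym : ∀ {u v} → Adj u v → col u v ≡ col v u

  record Subgraph : Set₁ where
    field
      W      : Fin n → Set
      E      : Fin n → Fin n → Set
      E⊆Adj  : ∀ {u v} → E u v → Adj u v
      E-sym  : ∀ {u v} → E u v → E v u
      E⊆W    : ∀ {u v} → E u v → W u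

  data Walk (E : Fin n → Fin n → Set) : Fin n → Fin n → Set where
    here : ∀ {u} → Walk E u u
    step : ∀ {u v w} → E u v → Walk E v w → Walk E u w

  -- A cycle in E: m+3 distinct vertices f 0, …, f (m+2), consecutive ones
  -- joined by edges of E, and f (m+2) joined to f 0.
  record Cycle (E : Fin n → Fin n → Set) : Set where
    field
      m        : ℕ
      f        : Fin (suc (suc (suc m))) → Fin n
      f-inj    : ∀ i j → f i ≡ f j → i ≡ j
      consec   : ∀ (i : Fin (suc (suc m))) → E (f (inject₁ i)) (f (fsuc i))
      closing  : E (f (fromℕ (suc (suc m)))) (f fzero)

  IsTree : Subgraph → Set
  IsTree H = Connected × ¬ Cycle E
    where
      open Subgraph H
      Connected : Set
      Connected = ∀ u v → W u → W v → Walk E u v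

  IsRainbow : ∀ {k} → EdgeColoring k → Subgraph → Set
  IsRainbow c H = ∀ {u v x y} → E u v → E x y → col u v ≡ col x y →
                  (u ≡ x × v ≡ y) ⊎ (u ≡ y × v ≡ x)
    where
      open Subgraph H
      open EdgeColoring c

  RainbowTreeFor : ∀ {k} → EdgeColoring k → Fin n → Fin n → Fin n → Set₁
  RainbowTreeFor c a b d =
    Σ Subgraph λ H → IsTree H × IsRainbow c H ×
      (Subgraph.W H a × Subgraph.W H b × Subgraph.W H d)

  Is3RainbowColoring : ∀ {k} → EdgeColoring k → Set₁
  Is3RainbowColoring c = ∀ a b d → ¬ a ≡ b → ¬ a ≡ d → ¬ b ≡ d →
                         RainbowTreeFor c a b d

  3RainbowColorable : ℕ → Set₁
  3RainbowColorable k = Σ (EdgeColoring k) Is3RainbowColoring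

  rx3≡ : ℕ → Set₁
  rx3≡ r = 3RainbowColorable r × (∀ k → k < r → ¬ 3RainbowColorable k)

  rx3≥ : ℕ → Set₁
  rx3≥ r = ∀ k → 3RainbowColorable k → r ≤ k

-- K_{2,t}: vertices Fin (2 + t); vertices 0,1 form the part of size 2,
-- vertices 2,…,t+1 the part of size t.
K2 : ℕ → Graph
K2 t = record
  { n = 2 + t
  ; Adj = λ u v → (toℕ u < 2 × 2 ≤ toℕ v) ⊎ (2 ≤ toℕ u × toℕ v < 2)
  ; sym = λ { (inj₁ (p , q)) → inj₂ (q , p) ; (inj₂ (p , q)) → inj₁ (q , p) }
  ; irrefl = irr
  }
  where
    open import Data.Nat.Properties using (<⇒≱)
    irr : ∀ {u} → ¬ ((toℕ u < 2 × 2 ≤ toℕ u) ⊎ (2 ≤ toℕ u × toℕ u < 2))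
    irr (inj₁ (p , q)) = <⇒≱ p q
    irr (inj₂ (p , q)) = <⇒≱ q p

module Submission where

-- Every edge of K_{2,t} joins a leaf to one of the centres x, y, so a colouring
-- assigns each leaf a profile: the colours of its edges to x and to y.  A tree
-- through three leaves i, j, l is a star at one centre or passes through a
-- hub leaf z joined to both centres; if z ∉ {i, j, l} it has five edges.  So
-- with at most four colours the three profiles are compatible: one coordinate
-- is rainbow, or for one of the leaves its two colours and one colour of each
-- other leaf are distinct.
--
-- Lower bounds: a 3-rainbow colouring with k ≤ 3 (resp. 4) colours of K_{2,t},
-- t ≥ 5 (resp. 9), yields 5 (resp. 9) profiles over 3 (resp. 4) colours any
-- three of which are compatible, and an exhaustive search over multisets of
-- profiles, proved sound by double counting, shows that none exist.  Upper bound: the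
-- eight ordered pairs of colours adjacent on the 4-cycle 0–1–3–2–0 colour up
-- to eight leaves; for every triple of vertices a star or double star is
-- checked by evaluation, and general lemmas turn such spoke lists into rainbow
-- trees.

open import Defs
open import Data.Nat using (ℕ; zero; suc; _+_; _≤_; _<_; z≤n; s≤s; _≡ᵇ_)
import Data.Nat.Properties as ℕ
open import Data.Nat.ListAction using (sum)
open import Data.Fin using (Fin; toℕ; inject≤; fromℕ<) renaming (zero to fzero; suc to fsuc; _<_ to _<ᶠ_)
import Data.Fin.Properties as Fin
open import Data.Product using (Σ; ∃; ∃₂; _×_; _,_; proj₁; proj₂)
open import Data.Product.Properties using (≡-dec)
open import Data.Sum using (_⊎_; inj₁; inj₂)
open import Data.Empty using (⊥; ⊥-elim)
open import Data.Unit using (tt)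
open import Data.Bool using (Bool; true; false; T; not; _∧_; _∨_)
open import Data.Bool.Properties using (T-∧; T-∨)
open import Data.Bool.ListAction using (any)
open import Data.Vec as Vec using (Vec)
import Data.Vec.Relation.Unary.Unique.Propositional as Vec
open import Data.Vec.Relation.Unary.Unique.Propositional.Properties using (lookup-injective)
open import Data.Vec.Relation.Unary.AllPairs using ([]; _∷_)
open import Data.Vec.Relation.Unary.All using ([]; _∷_)
open import Data.List using (List; []; _∷_; [_]; map; _++_; concatMap; filter; length; allFin; upTo; cartesianProduct)
open import Data.List.Properties using (map-cong; length-map; length-tabulate)
open import Data.List.Membership.Propositional using (_∈_; _∉_)
open import Data.List.Membership.Propositional.Properties using (∈-map⁺)
open import Data.List.Relation.Unary.Any as Any using (Any; here; there; any?)
open import Data.List.Relation.Unary.Any.Properties using (any⁺)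
open import Data.List.Relation.Unary.All as All using (All; all?; []; _∷_)
open import Data.List.Relation.Unary.All.Properties using (all-filter; map⁺)
open import Data.List.Relation.Unary.AllPairs as AllPairs using (AllPairs; []; _∷_)
open import Data.List.Relation.Unary.AllPairs.Properties using () renaming (map⁺ to pairs-map⁺)
open import Data.List.Relation.Unary.Unique.Propositional using (Unique)
open import Data.List.Relation.Unary.Unique.Propositional.Properties using (filter⁺; allFin⁺)
open import Algebra.Properties.CommutativeSemigroup ℕ.+-commutativeSemigroup using (interchange)
open import Function using (_∘_; id)
open import Function.Bundles using (Equivalence)
open import Relation.Binary.Definitions using (DecidableEquality; tri<; tri≈; tri>)
open import Relation.Nullary using (¬_; Dec; yes; no)
open import Relation.Nullary.Decidable using (True; toWitness; _×-dec_; _⊎-dec_; _→-dec_; ¬?)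
open import Relation.Unary using (Decidable)
open import Relation.Binary.PropositionalEquality
  using (_≡_; _≢_; refl; sym; trans; cong; cong₂; subst; subst₂; module ≡-Reasoning)

apart : ∀ {A : Set} {n} {f : Fin n → A} {i j} → (∀ i j → f i ≡ f j → i ≡ j) → i ≢ j → f i ≢ f j
apart inj i≢j eq = i≢j (inj _ _ eq)

unique-map-injective : ∀ {A B : Set} {f : A → B} {xs x y} →
                       Unique (map f xs) → x ∈ xs → y ∈ xs → f x ≡ f y → x ≡ y
unique-map-injective _ (here refl) (here refl) _ = refl
unique-map-injective {f = f} (fx∉ ∷ _) (here refl) (there y∈) eq = ⊥-elim (All.lookup fx∉ (∈-map⁺ f y∈) eq)
unique-map-injective {f = f} (fy∉ ∷ _) (there x∈) (here refl) eq = ⊥-elim (All.lookup fy∉ (∈-map⁺ f x∈) (sym eq))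
unique-map-injective (_ ∷ u) (there x∈) (there y∈) eq = unique-map-injective u x∈ y∈ eq

module _ {G : Graph} {E : Fin (Graph.n G) → Fin (Graph.n G) → Set} where

  _++ʷ_ : ∀ {u v w} → Walk G E u v → Walk G E v w → Walk G E u w
  here ++ʷ q = q
  step e p ++ʷ q = step e (p ++ʷ q)

  reverseʷ : (∀ {u v} → E u v → E v u) → ∀ {u v} → Walk G E u v → Walk G E v u
  reverseʷ E-sym here = here
  reverseʷ E-sym (step e p) = reverseʷ E-sym p ++ʷ step (E-sym e) here

module _ {n} (P : Fin n → Fin n → Fin n → Set₁)
         (swap₁₂ : ∀ {a b d} → P a b d → P b a d) (swap₂₃ : ∀ {a b d} → P a b d → P a d b) where

  private
    order : ∀ {a b : Fin n} → a ≢ b → a <ᶠ b ⊎ b <ᶠ a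
    order {a} {b} a≢b with Fin.<-cmp a b
    ... | tri< a<b _ _ = inj₁ a<b
    ... | tri≈ _ a≡b _ = ⊥-elim (a≢b a≡b)
    ... | tri> _ _ b<a = inj₂ b<a

  from-increasing : (∀ {a b d} → a <ᶠ b → b <ᶠ d → P a b d) →
                    ∀ a b d → a ≢ b → a ≢ d → b ≢ d → P a b d
  from-increasing inc a b d a≢b a≢d b≢d with order a≢b | order b≢d | order a≢d
  ... | inj₁ a<b | inj₁ b<d | _        = inc a<b b<d
  ... | inj₁ a<b | inj₂ d<b | inj₁ a<d = swap₂₃ (inc a<d d<b)
  ... | inj₁ a<b | inj₂ d<b | inj₂ d<a = swap₂₃ (swap₁₂ (inc d<a a<b))
  ... | inj₂ b<a | inj₁ b<d | inj₁ a<d = swap₁₂ (inc b<a a<d)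
  ... | inj₂ b<a | inj₁ b<d | inj₂ d<a = swap₁₂ (swap₂₃ (inc b<d d<a))
  ... | inj₂ b<a | inj₂ d<b | _        = swap₁₂ (swap₂₃ (swap₁₂ (inc d<b b<a)))

distinct₃ : ∀ {A : Set} {a b c : A} → a ≢ b → a ≢ c → b ≢ c → Unique (a ∷ b ∷ c ∷ [])
distinct₃ a≢b a≢c b≢c = (a≢b ∷ a≢c ∷ []) ∷ (b≢c ∷ []) ∷ [] ∷ []

distinct₄ : ∀ {A : Set} {a b c d : A} → a ≢ b → a ≢ c → a ≢ d → b ≢ c → b ≢ d → c ≢ d →
            Unique (a ∷ b ∷ c ∷ d ∷ [])
distinct₄ a≢b a≢c a≢d b≢c b≢d c≢d = (a≢b ∷ a≢c ∷ a≢d ∷ []) ∷ distinct₃ b≢c b≢d c≢d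

distinct₅ : ∀ {A : Set} {a b c d e : A} → a ≢ b → a ≢ c → a ≢ d → a ≢ e → b ≢ c → b ≢ d → b ≢ e →
            c ≢ d → c ≢ e → d ≢ e → Vec.Unique (a Vec.∷ b Vec.∷ c Vec.∷ d Vec.∷ e Vec.∷ Vec.[])
distinct₅ a≢b a≢c a≢d a≢e b≢c b≢d b≢e c≢d c≢e d≢e =
  (a≢b ∷ a≢c ∷ a≢d ∷ a≢e ∷ []) ∷ (b≢c ∷ b≢d ∷ b≢e ∷ []) ∷ (c≢d ∷ c≢e ∷ []) ∷ (d≢e ∷ []) ∷ [] ∷ []

distinct-≤ : ∀ {k n} {v : Vec (Fin k) n} → Vec.Unique v → n ≤ k
distinct-≤ u = Fin.injective⇒≤ (λ {i} {j} → lookup-injective u i j)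

pattern centreX = fzero
pattern centreY = fsuc fzero
pattern leaf l = fsuc (fsuc l)

centre : ∀ {t} → Fin 2 → Fin (2 + t)
centre fzero = centreX
centre (fsuc fzero) = centreY

colourAt : ∀ {A : Set} → Fin 2 → A × A → A
colourAt fzero = proj₁
colourAt (fsuc fzero) = proj₂

module _ {t : ℕ} where

  private
    Adj : Fin (2 + t) → Fin (2 + t) → Set
    Adj = Graph.Adj (K2 t)

  IsCentre IsLeaf : Fin (2 + t) → Set
  IsCentre v = toℕ v < 2
  IsLeaf v = 2 ≤ toℕ v

  leaf≢centre : ∀ {v} → IsCentre v → ¬ IsLeaf v
  leaf≢centre c l = ℕ.<⇒≱ c l

  after-centre : ∀ {u v} → IsCentre u → Adj u v → IsLeaf v
  after-centre c (inj₁ (_ , l)) = l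
  after-centre c (inj₂ (l , _)) = ⊥-elim (leaf≢centre c l)

  after-leaf : ∀ {u v} → IsLeaf u → Adj u v → IsCentre v
  after-leaf l (inj₁ (c , _)) = ⊥-elim (leaf≢centre c l)
  after-leaf l (inj₂ (_ , c)) = c

  centre-is-centre : ∀ s → IsCentre (centre s)
  centre-is-centre fzero = s≤s z≤n
  centre-is-centre (fsuc fzero) = s≤s (s≤s z≤n)

  leaf-is-leaf : ∀ l → IsLeaf (leaf l)
  leaf-is-leaf _ = s≤s (s≤s z≤n)

  leaves-not-adjacent : ∀ {i j} → ¬ Adj (leaf i) (leaf j)
  leaves-not-adjacent {i} {j} adj = leaf≢centre (after-leaf (leaf-is-leaf i) adj) (leaf-is-leaf j)

  centres-not-adjacent : ∀ s s′ → ¬ Adj (centre s) (centre s′)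
  centres-not-adjacent s s′ adj = leaf≢centre (centre-is-centre s′) (after-centre (centre-is-centre s) adj)

  two-centres : ∀ {u v} → IsCentre u → IsCentre v → u ≢ v →
                (u ≡ centreX × v ≡ centreY) ⊎ (u ≡ centreY × v ≡ centreX)
  two-centres {centreX} {centreX} _ _ u≢v = ⊥-elim (u≢v refl)
  two-centres {centreX} {centreY} _ _ _ = inj₁ (refl , refl)
  two-centres {centreY} {centreX} _ _ _ = inj₂ (refl , refl)
  two-centres {centreY} {centreY} _ _ u≢v = ⊥-elim (u≢v refl)
  two-centres {leaf _} (s≤s (s≤s ())) _ _
  two-centres {_} {leaf _} _ (s≤s (s≤s ())) _

  no-three-centres : ∀ {u v w} → IsCentre u → IsCentre v → IsCentre w →
                     u ≢ v → u ≢ w → v ≢ w → ⊥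
  no-three-centres cu cv cw u≢v u≢w v≢w with two-centres cu cv u≢v | two-centres cu cw u≢w
  ... | inj₁ (refl , refl) | inj₁ (_ , refl) = v≢w refl
  ... | inj₁ (refl , _)    | inj₂ (() , _)
  ... | inj₂ (refl , _)    | inj₁ (() , _)
  ... | inj₂ (refl , refl) | inj₂ (_ , refl) = v≢w refl

  -- A subgraph of K_{2,t} in which at most one leaf is joined to both centres
  -- has no cycle: a 4-cycle needs two such leaves, and a longer cycle would
  -- pass through three distinct centres.
  module _ (E : Fin (2 + t) → Fin (2 + t) → Set)
           (E⊆Adj : ∀ {u v} → E u v → Adj u v)
           (E-sym : ∀ {u v} → E u v → E v u)
           (one-hub : ∀ {p q} → E p centreX → E p centreY → E q centreX → E q centreY → p ≡ q)
           where

    two-steps : ∀ {u v w} → IsCentre u → E u v → E v w → IsCentre w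
    two-steps c e e′ = after-leaf (after-centre c (E⊆Adj e)) (E⊆Adj e′)

    no-triangle : ∀ {a b c} → E a b → E b c → E c a → ⊥
    no-triangle ab bc ca with E⊆Adj ab
    ... | inj₁ (cₐ , _) = leaf≢centre (two-steps cₐ ab bc) (after-centre cₐ (E⊆Adj (E-sym ca)))
    ... | inj₂ (_ , c_b) = leaf≢centre (two-steps c_b bc ca) (after-centre c_b (E⊆Adj (E-sym ab)))

    no-square : ∀ {a b c d} → E a b → E b c → E c d → E d a → a ≢ c → b ≢ d → ⊥
    no-square {a} {b} {c} {d} ab bc cd da a≢c b≢d with E⊆Adj ab
    ... | inj₁ (cₐ , _) with two-centres cₐ (two-steps cₐ ab bc) a≢c
    ...   | inj₁ (refl , refl) = b≢d (one-hub (E-sym ab) bc da (E-sym cd))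
    ...   | inj₂ (refl , refl) = b≢d (one-hub bc (E-sym ab) (E-sym cd) da)
    no-square {a} {b} {c} {d} ab bc cd da a≢c b≢d | inj₂ (_ , c_b) with two-centres c_b (two-steps c_b bc cd) b≢d
    ...   | inj₁ (refl , refl) = a≢c (one-hub ab (E-sym da) (E-sym bc) cd)
    ...   | inj₂ (refl , refl) = a≢c (one-hub (E-sym da) ab cd (E-sym bc))

    -- A path v₀ … v₅ whose even and odd vertices are pairwise distinct
    -- contains three distinct centres.
    no-long-path : ∀ {v₀ v₁ v₂ v₃ v₄ v₅} →
                   E v₀ v₁ → E v₁ v₂ → E v₂ v₃ → E v₃ v₄ → E v₄ v₅ →
                   v₀ ≢ v₂ → v₀ ≢ v₄ → v₂ ≢ v₄ → v₁ ≢ v₃ → v₁ ≢ v₅ → v₃ ≢ v₅ → ⊥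
    no-long-path e₀ e₁ e₂ e₃ e₄ n₀₂ n₀₄ n₂₄ n₁₃ n₁₅ n₃₅ with E⊆Adj e₀
    ... | inj₁ (c₀ , _) =
      no-three-centres c₀ (two-steps c₀ e₀ e₁) (two-steps (two-steps c₀ e₀ e₁) e₂ e₃) n₀₂ n₀₄ n₂₄
    ... | inj₂ (_ , c₁) =
      no-three-centres c₁ (two-steps c₁ e₁ e₂) (two-steps (two-steps c₁ e₁ e₂) e₃ e₄) n₁₃ n₁₅ n₃₅

    -- Cycles of length 3, 4, and at least 5 (of which five edges are used).
    acyclic : ¬ Cycle (K2 t) E
    acyclic record { m = zero ; consec = e ; closing = e′ } =
      no-triangle (e fzero) (e (fsuc fzero)) e′
    acyclic record { m = suc zero ; f-inj = inj ; consec = e ; closing = e′ } =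
      no-square (e fzero) (e (fsuc fzero)) (e (fsuc (fsuc fzero))) e′
        (apart inj λ ()) (apart inj λ ())
    acyclic record { m = suc (suc zero) ; f-inj = inj ; consec = e ; closing = e′ } =
      no-long-path (e fzero) (e (fsuc fzero)) (e (fsuc (fsuc fzero))) (e (fsuc (fsuc (fsuc fzero)))) e′
        (apart inj λ ()) (apart inj λ ()) (apart inj λ ()) (apart inj λ ()) (apart inj λ ()) (apart inj λ ())
    acyclic record { m = suc (suc (suc _)) ; f-inj = inj ; consec = e } =
      no-long-path (e fzero) (e (fsuc fzero)) (e (fsuc (fsuc fzero))) (e (fsuc (fsuc (fsuc fzero))))
        (e (fsuc (fsuc (fsuc (fsuc fzero)))))
        (apart inj λ ()) (apart inj λ ()) (apart inj λ ()) (apart inj λ ()) (apart inj λ ()) (apart inj λ ())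

leaf-injective : ∀ {t} {i j : Fin t} → _≡_ {A = Fin (2 + t)} (leaf i) (leaf j) → i ≡ j
leaf-injective refl = refl

centre-injective : ∀ {t} {s s′ : Fin 2} → centre {t} s ≡ centre s′ → s ≡ s′
centre-injective {s = fzero} {fzero} _ = refl
centre-injective {s = fzero} {fsuc fzero} ()
centre-injective {s = fsuc fzero} {fzero} ()
centre-injective {s = fsuc fzero} {fsuc fzero} _ = refl

leaf≢centreᵛ : ∀ {t} {i : Fin t} s → leaf i ≢ centre s
leaf≢centreᵛ fzero ()
leaf≢centreᵛ (fsuc fzero) ()

-- The 4-colouring of K_{2,t} in which leaf l has the given profile, and a
-- decision procedure showing that it is 3-rainbow: candidate trees are lists
-- of spokes, and simple decidable conditions make such a list a rainbow tree.
module ProfileColouring {t : ℕ} (profile : Fin t → Fin 4 × Fin 4) where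

  open import Data.List.Membership.DecPropositional (≡-dec (Fin._≟_ {t}) (Fin._≟_ {2})) using (_∈?_)
  open import Data.List.Relation.Unary.Unique.DecPropositional (Fin._≟_ {4}) using (unique?)

  G : Graph
  G = K2 t

  -- Non-edges get an arbitrary colour.
  colour : Fin (2 + t) → Fin (2 + t) → Fin 4
  colour (leaf l) centreX = colourAt fzero (profile l)
  colour (leaf l) centreY = colourAt (fsuc fzero) (profile l)
  colour centreX (leaf l) = colourAt fzero (profile l)
  colour centreY (leaf l) = colourAt (fsuc fzero) (profile l)
  colour _ _ = fzero

  colour-sym : ∀ u v → colour u v ≡ colour v u
  colour-sym centreX centreX = refl
  colour-sym centreX centreY = refl
  colour-sym centreX (leaf l) = refl
  colour-sym centreY centreX = refl
  colour-sym centreY centreY = refl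
  colour-sym centreY (leaf l) = refl
  colour-sym (leaf l) centreX = refl
  colour-sym (leaf l) centreY = refl
  colour-sym (leaf l) (leaf l') = refl

  colouring : EdgeColoring G 4
  colouring = record { col = colour ; col-sym = λ {u} {v} _ → colour-sym u v }

  -- A spoke (l , s) is the edge between leaf l and centre s; a candidate
  -- tree is given by its list of spokes.
  Spoke : Set
  Spoke = Fin t × Fin 2

  spokeColour : Spoke → Fin 4
  spokeColour (l , s) = colourAt s (profile l)

  Joins : List Spoke → Fin (2 + t) → Fin (2 + t) → Set
  Joins es (leaf l) centreX = (l , fzero) ∈ es
  Joins es (leaf l) centreY = (l , fsuc fzero) ∈ es
  Joins es centreX (leaf l) = (l , fzero) ∈ es
  Joins es centreY (leaf l) = (l , fsuc fzero) ∈ es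
  Joins es _ _ = ⊥

  Ends : Spoke → Fin (2 + t) → Fin (2 + t) → Set
  Ends (l , s) u v = (u ≡ leaf l × v ≡ centre s) ⊎ (u ≡ centre s × v ≡ leaf l)

  joins-spoke : ∀ {es u v} → Joins es u v → Σ Spoke λ e → e ∈ es × Ends e u v
  joins-spoke {u = leaf l} {centreX} e = _ , e , inj₁ (refl , refl)
  joins-spoke {u = leaf l} {centreY} e = _ , e , inj₁ (refl , refl)
  joins-spoke {u = centreX} {leaf l} e = _ , e , inj₂ (refl , refl)
  joins-spoke {u = centreY} {leaf l} e = _ , e , inj₂ (refl , refl)
  joins-spoke {u = centreX} {centreX} ()
  joins-spoke {u = centreX} {centreY} ()
  joins-spoke {u = centreY} {centreX} ()
  joins-spoke {u = centreY} {centreY} ()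
  joins-spoke {u = leaf _} {leaf _} ()

  spoke-joins : ∀ {es l} s → (l , s) ∈ es → Joins es (leaf l) (centre s) × Joins es (centre s) (leaf l)
  spoke-joins fzero e = e , e
  spoke-joins (fsuc fzero) e = e , e

  spoke-colour : ∀ l s → colour (leaf l) (centre s) ≡ spokeColour (l , s) × colour (centre s) (leaf l) ≡ spokeColour (l , s)
  spoke-colour l fzero = refl , refl
  spoke-colour l (fsuc fzero) = refl , refl

  joins-adj : ∀ {es u v} → Joins es u v → Graph.Adj G u v
  joins-adj j with joins-spoke j
  ... | (_ , s) , _ , inj₁ (refl , refl) = inj₂ (leaf-is-leaf _ , centre-is-centre s)
  ... | (_ , s) , _ , inj₂ (refl , refl) = inj₁ (centre-is-centre s , leaf-is-leaf _)

  joins-sym : ∀ {es u v} → Joins es u v → Joins es v u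
  joins-sym j with joins-spoke j
  ... | (_ , s) , e∈ , inj₁ (refl , refl) = proj₂ (spoke-joins s e∈)
  ... | (_ , s) , e∈ , inj₂ (refl , refl) = proj₁ (spoke-joins s e∈)

  joins? : ∀ es u v → Dec (Joins es u v)
  joins? es (leaf l) centreX = (l , fzero) ∈? es
  joins? es (leaf l) centreY = (l , fsuc fzero) ∈? es
  joins? es centreX (leaf l) = (l , fzero) ∈? es
  joins? es centreY (leaf l) = (l , fsuc fzero) ∈? es
  joins? es centreX centreX = no λ ()
  joins? es centreX centreY = no λ ()
  joins? es centreY centreX = no λ ()
  joins? es centreY centreY = no λ ()
  joins? es (leaf _) (leaf _) = no λ ()

  Touches : List Spoke → Fin (2 + t) → Set
  Touches es u = Σ (Fin (2 + t)) (Joins es u)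

  spokeGraph : List Spoke → Subgraph G
  spokeGraph es = record
    { W = Touches es ; E = Joins es ; E⊆Adj = joins-adj ; E-sym = joins-sym ; E⊆W = λ j → _ , j }

  -- Spokes of pairwise distinct colours form a rainbow subgraph: an edge has
  -- the colour of its spoke, and equal spokes have equal ends.
  ends-colour : ∀ {e u v} → Ends e u v → colour u v ≡ spokeColour e
  ends-colour {l , s} (inj₁ (refl , refl)) = proj₁ (spoke-colour l s)
  ends-colour {l , s} (inj₂ (refl , refl)) = proj₂ (spoke-colour l s)

  same-ends : ∀ {e u v u′ v′} → Ends e u v → Ends e u′ v′ → (u ≡ u′ × v ≡ v′) ⊎ (u ≡ v′ × v ≡ u′)
  same-ends (inj₁ (refl , refl)) (inj₁ (refl , refl)) = inj₁ (refl , refl)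
  same-ends (inj₁ (refl , refl)) (inj₂ (refl , refl)) = inj₂ (refl , refl)
  same-ends (inj₂ (refl , refl)) (inj₁ (refl , refl)) = inj₂ (refl , refl)
  same-ends (inj₂ (refl , refl)) (inj₂ (refl , refl)) = inj₁ (refl , refl)

  spokes-rainbow : ∀ {es} → Unique (map spokeColour es) → IsRainbow G colouring (spokeGraph es)
  spokes-rainbow u j j′ same
    with _ , e∈ , ends ← joins-spoke j | _ , e′∈ , ends′ ← joins-spoke j′
    with refl ← unique-map-injective u e∈ e′∈ (trans (sym (ends-colour ends)) (trans same (ends-colour ends′)))
    = same-ends ends ends′

  -- A connectivity certificate: either every spoke ends at one centre s
  -- (a star), or some hub leaf z is joined to both centres.
  StarAt : List Spoke → Fin 2 → Set
  StarAt es s = All (λ e → proj₂ e ≡ s) es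

  HubAt : List Spoke → Fin t → Set
  HubAt es z = (z , fzero) ∈ es × (z , fsuc fzero) ∈ es

  Rooted : List Spoke → Set
  Rooted es = ∃ (StarAt es) ⊎ ∃ (HubAt es)

  root : ∀ {es} → Rooted es → Fin (2 + t)
  root (inj₁ (s , _)) = centre s
  root (inj₂ _) = centreX

  via-hub : ∀ {es z} → HubAt es z → ∀ s → Walk G (Joins es) (centre s) centreX
  via-hub _ fzero = here
  via-hub {z = z} (zx , zy) (fsuc fzero) = step {v = leaf z} zy (step zx here)

  to-root : ∀ {es} (r : Rooted es) {u v} → Joins es u v → Walk G (Joins es) u (root r)
  to-root (inj₁ (s , star)) j with joins-spoke j
  ... | _ , e∈ , inj₁ (refl , refl) with refl ← All.lookup star e∈ = step j here
  ... | _ , e∈ , inj₂ (refl , refl) with refl ← All.lookup star e∈ = here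
  to-root (inj₂ (_ , hub)) j with joins-spoke j
  ... | (_ , s) , _ , inj₁ (refl , refl) = step j (via-hub hub s)
  ... | (_ , s) , _ , inj₂ (refl , refl) = via-hub hub s

  spokes-connected : ∀ {es} → Rooted es → ∀ u v → Touches es u → Touches es v → Walk G (Joins es) u v
  spokes-connected r u v (_ , ju) (_ , jv) = to-root r ju ++ʷ reverseʷ joins-sym (to-root r jv)

  OneHub : List Spoke → Set
  OneHub es = All (λ e → All (λ e′ → HubAt es (proj₁ e) → HubAt es (proj₁ e′) → proj₁ e ≡ proj₁ e′) es) es

  one-hub : ∀ {es} → OneHub es → ∀ {p q} → Joins es p centreX → Joins es p centreY →
            Joins es q centreX → Joins es q centreY → p ≡ q
  one-hub h {leaf _} {leaf _} px py qx qy = cong leaf (All.lookup (All.lookup h px) qx (px , py) (qx , qy))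
  one-hub h {centreX} () _ _ _
  one-hub h {centreY} () _ _ _
  one-hub h {leaf _} {centreX} _ _ () _
  one-hub h {leaf _} {centreY} _ _ () _

  IsGoodTree : List Spoke → Fin (2 + t) → Fin (2 + t) → Fin (2 + t) → Set
  IsGoodTree es a b d = Unique (map spokeColour es) × Rooted es × OneHub es ×
                        Touches es a × Touches es b × Touches es d

  good-tree : ∀ {es a b d} → IsGoodTree es a b d → RainbowTreeFor G colouring a b d
  good-tree {es} (u , r , h , wa , wb , wd) =
    spokeGraph es , (spokes-connected r , acyclic (Joins es) joins-adj joins-sym (one-hub h)) ,
    spokes-rainbow u , wa , wb , wd

  isGoodTree? : ∀ es a b d → Dec (IsGoodTree es a b d)
  isGoodTree? es a b d =
    unique? (map spokeColour es)
    ×-dec (Fin.any? (λ s → all? (λ e → proj₂ e Fin.≟ s) es) ⊎-dec Fin.any? hub?)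
    ×-dec all? (λ e → all? (λ e′ → hub? (proj₁ e) →-dec hub? (proj₁ e′) →-dec proj₁ e Fin.≟ proj₁ e′) es) es
    ×-dec touches? a ×-dec touches? b ×-dec touches? d
    where
      hub? : ∀ z → Dec (HubAt es z)
      hub? z = (z , fzero) ∈? es ×-dec (z , fsuc fzero) ∈? es
      touches? : ∀ v → Dec (Touches es v)
      touches? v = Fin.any? (joins? es v)

  -- Candidate trees for S: the two stars on the leaves of S, and for every
  -- hub leaf z the double stars attaching each other leaf of S to a centre.
  leavesOf : List (Fin (2 + t)) → List (Fin t)
  leavesOf [] = []
  leavesOf (leaf l ∷ vs) = l ∷ leavesOf vs
  leavesOf (centreX ∷ vs) = leavesOf vs
  leavesOf (centreY ∷ vs) = leavesOf vs

  attachments : List (Fin t) → List (List Spoke)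
  attachments [] = [ [] ]
  attachments (l ∷ ls) = concatMap (λ es → ((l , fzero) ∷ es) ∷ ((l , fsuc fzero) ∷ es) ∷ []) (attachments ls)

  -- Hubs inside S are tried first, which keeps the evaluation short.
  candidates : List (Fin (2 + t)) → List (List Spoke)
  candidates S = map star (allFin 2) ++ concatMap double-star (leavesOf S ++ allFin t)
    where
      star : Fin 2 → List Spoke
      star s = map (_, s) (leavesOf S)
      double-star : Fin t → List (List Spoke)
      double-star z = map (λ es → (z , fzero) ∷ (z , fsuc fzero) ∷ es) (attachments (filter (λ l → ¬? (z Fin.≟ l)) (leavesOf S)))

  -- Every increasing triple of vertices has a good candidate tree; decidable,
  -- and enough by symmetry.
  AllTriplesCovered : Set
  AllTriplesCovered = ∀ a b d → a <ᶠ b → b <ᶠ d → Any (λ es → IsGoodTree es a b d) (candidates (a ∷ b ∷ d ∷ []))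

  allTriplesCovered? : Dec AllTriplesCovered
  allTriplesCovered? = Fin.all? λ a → Fin.all? λ b → Fin.all? λ d →
    a Fin.<? b →-dec b Fin.<? d →-dec any? (λ es → isGoodTree? es a b d) _

  rainbow-colouring : AllTriplesCovered → Is3RainbowColoring G colouring
  rainbow-colouring cover =
    from-increasing (RainbowTreeFor G colouring) swap₁₂ swap₂₃
      (λ {a} {b} {d} a<b b<d → good-tree (proj₂ (Any.satisfied (cover a b d a<b b<d))))
    where
      swap₁₂ : ∀ {a b d} → RainbowTreeFor G colouring a b d → RainbowTreeFor G colouring b a d
      swap₁₂ (H , tree , rb , wa , wb , wd) = H , tree , rb , wb , wa , wd
      swap₂₃ : ∀ {a b d} → RainbowTreeFor G colouring a b d → RainbowTreeFor G colouring a d b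
      swap₂₃ (H , tree , rb , wa , wb , wd) = H , tree , rb , wa , wd , wb

-- The eight ordered pairs of colours adjacent on the 4-cycle 0–1–3–2–0.
palette : Fin 8 → Fin 4 × Fin 4
palette fzero = fzero , fsuc fzero
palette (fsuc fzero) = fzero , fsuc (fsuc fzero)
palette (fsuc (fsuc fzero)) = fsuc fzero , fzero
palette (fsuc (fsuc (fsuc fzero))) = fsuc fzero , fsuc (fsuc (fsuc fzero))
palette (fsuc (fsuc (fsuc (fsuc fzero)))) = fsuc (fsuc fzero) , fzero
palette (fsuc (fsuc (fsuc (fsuc (fsuc fzero))))) = fsuc (fsuc fzero) , fsuc (fsuc (fsuc fzero))
palette (fsuc (fsuc (fsuc (fsuc (fsuc (fsuc fzero)))))) = fsuc (fsuc (fsuc fzero)) , fsuc fzero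
palette (fsuc (fsuc (fsuc (fsuc (fsuc (fsuc (fsuc fzero))))))) = fsuc (fsuc (fsuc fzero)) , fsuc (fsuc fzero)

palette-on : ∀ {t} → t ≤ 8 → Fin t → Fin 4 × Fin 4
palette-on t≤8 l = palette (inject≤ l t≤8)

palette-checked : ∀ t → 5 ≤ t → (t≤8 : t ≤ 8) → True (ProfileColouring.allTriplesCovered? (palette-on t≤8))
palette-checked 5 _ _ = tt
palette-checked 6 _ _ = tt
palette-checked 7 _ _ = tt
palette-checked 8 _ _ = tt
palette-checked 0 () _
palette-checked 1 (s≤s ()) _
palette-checked 2 (s≤s (s≤s ())) _
palette-checked 3 (s≤s (s≤s (s≤s ()))) _
palette-checked 4 (s≤s (s≤s (s≤s (s≤s ())))) _
palette-checked (suc (suc (suc (suc (suc (suc (suc (suc (suc _))))))))) _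
  (s≤s (s≤s (s≤s (s≤s (s≤s (s≤s (s≤s (s≤s ()))))))))

four-colourable : ∀ t → 5 ≤ t → t ≤ 8 → 3RainbowColorable (K2 t) 4
four-colourable t 5≤t t≤8 = colouring , rainbow-colouring (toWitness (palette-checked t 5≤t t≤8))
  where open ProfileColouring (palette-on t≤8)

-- The profile of a leaf: the colours of its edges to centre x and centre y.
Profile : Set
Profile = ℕ × ℕ

_≟ₚ_ : DecidableEquality Profile
_≟ₚ_ = ≡-dec ℕ._≟_ ℕ._≟_

-- The condition on the profiles p, q, r of three leaves in a rainbow tree with
-- at most four colours: the tree is a star at a centre s (the three s-colours
-- differ) or passes through one of the three leaves as hub (its two colours
-- and one colour of each other leaf differ).
Hub : Profile → Profile → Profile → Set
Hub p q r = ∃₂ λ s s′ → Unique (colourAt fzero p ∷ colourAt (fsuc fzero) p ∷ colourAt s q ∷ colourAt s′ r ∷ [])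

Compatible : Profile → Profile → Profile → Set
Compatible p q r = (∃ λ s → Unique (colourAt s p ∷ colourAt s q ∷ colourAt s r ∷ [])) ⊎ Hub p q r ⊎ Hub q p r ⊎ Hub r p q

module LeafProfiles {t k : ℕ} (c : EdgeColoring (K2 t) k) where

  open EdgeColoring c

  profile : Fin t → Profile
  profile i = toℕ (col (leaf i) centreX) , toℕ (col (leaf i) centreY)

  profile-colour : ∀ s i → colourAt s (profile i) ≡ toℕ (col (leaf i) (centre s))
  profile-colour fzero i = refl
  profile-colour (fsuc fzero) i = refl

  module InTree (H : Subgraph (K2 t)) (tree : IsTree (K2 t) H) (rainbow : IsRainbow (K2 t) c H) where

    open Subgraph H

    attached : ∀ {i v} → W (leaf i) → W v → leaf i ≢ v → ∃ λ s → E (leaf i) (centre s)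
    attached wi wv ne with proj₁ tree _ _ wi wv
    ... | here = ⊥-elim (ne refl)
    ... | step {v = centreX} e _ = fzero , e
    ... | step {v = centreY} e _ = fsuc fzero , e
    ... | step {v = leaf _} e _ = ⊥-elim (leaves-not-adjacent (E⊆Adj e))

    bridge : Walk (K2 t) E centreX centreY → ∃ λ z → E (leaf z) centreX × E (leaf z) centreY
    bridge (step {v = centreX} e _) = ⊥-elim (centres-not-adjacent {t} fzero fzero (E⊆Adj e))
    bridge (step {v = centreY} e _) = ⊥-elim (centres-not-adjacent {t} fzero (fsuc fzero) (E⊆Adj e))
    bridge (step {v = leaf z} e (step {v = centreX} _ w)) = bridge w
    bridge (step {v = leaf z} e (step {v = centreY} e′ _)) = z , E-sym e , e′
    bridge (step {v = leaf z} e (step {v = leaf _} e′ _)) = ⊥-elim (leaves-not-adjacent (E⊆Adj e′))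

    hub-leaf : ∀ {i j s s′} → s ≢ s′ → E (leaf i) (centre s) → E (leaf j) (centre s′) →
               ∃ λ z → E (leaf z) centreX × E (leaf z) centreY
    hub-leaf {s = fzero} {fzero} s≢s′ _ _ = ⊥-elim (s≢s′ refl)
    hub-leaf {s = fzero} {fsuc fzero} _ ei ej = bridge (proj₁ tree _ _ (E⊆W (E-sym ei)) (E⊆W (E-sym ej)))
    hub-leaf {s = fsuc fzero} {fzero} _ ei ej = bridge (proj₁ tree _ _ (E⊆W (E-sym ej)) (E⊆W (E-sym ei)))
    hub-leaf {s = fsuc fzero} {fsuc fzero} s≢s′ _ _ = ⊥-elim (s≢s′ refl)

    colours-differ : ∀ {p q s s′} → E (leaf p) (centre s) → E (leaf q) (centre s′) → p ≢ q ⊎ s ≢ s′ →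
                     col (leaf p) (centre s) ≢ col (leaf q) (centre s′)
    colours-differ ep eq apart same with rainbow ep eq same
    colours-differ ep eq (inj₁ p≢q) same | inj₁ (lp≡lq , _) = p≢q (leaf-injective lp≡lq)
    colours-differ ep eq (inj₂ s≢s′) same | inj₁ (_ , cs≡cs′) = s≢s′ (centre-injective cs≡cs′)
    ... | inj₂ (lp≡cs′ , _) = leaf≢centreᵛ _ lp≡cs′

    differ : ∀ {p q s s′} → E (leaf p) (centre s) → E (leaf q) (centre s′) → p ≢ q ⊎ s ≢ s′ →
             colourAt s (profile p) ≢ colourAt s′ (profile q)
    differ {p} {q} {s} {s′} ep eq apart same =
      colours-differ ep eq apart (Fin.toℕ-injective (trans (sym (profile-colour s p)) (trans same (profile-colour s′ q))))

    module Triple (k≤4 : k ≤ 4) {i j l} (i≢j : i ≢ j) (i≢l : i ≢ l) (j≢l : j ≢ l)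
                  {sᵢ sⱼ sₗ} (eᵢ : E (leaf i) (centre sᵢ)) (eⱼ : E (leaf j) (centre sⱼ))
                  (eₗ : E (leaf l) (centre sₗ)) where

      x≢y : _≢_ {A = Fin 2} fzero (fsuc fzero)
      x≢y ()

      -- With at
      -- most four colours z is one of i, j, l: otherwise its two edges and the
      -- edges at i, j, l would carry five distinct colours.
      through-hub : ∀ z → E (leaf z) centreX → E (leaf z) centreY →
                    Compatible (profile i) (profile j) (profile l)
      through-hub z zx zy with z Fin.≟ i | z Fin.≟ j | z Fin.≟ l
      ... | yes refl | _ | _ = inj₂ (inj₁ (sⱼ , sₗ , distinct₄
            (differ zx zy (inj₂ x≢y)) (differ zx eⱼ (inj₁ i≢j)) (differ zx eₗ (inj₁ i≢l))
            (differ zy eⱼ (inj₁ i≢j)) (differ zy eₗ (inj₁ i≢l)) (differ eⱼ eₗ (inj₁ j≢l))))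
      ... | no _ | yes refl | _ = inj₂ (inj₂ (inj₁ (sᵢ , sₗ , distinct₄
            (differ zx zy (inj₂ x≢y)) (differ zx eᵢ (inj₁ (i≢j ∘ sym))) (differ zx eₗ (inj₁ j≢l))
            (differ zy eᵢ (inj₁ (i≢j ∘ sym))) (differ zy eₗ (inj₁ j≢l)) (differ eᵢ eₗ (inj₁ i≢l)))))
      ... | no _ | no _ | yes refl = inj₂ (inj₂ (inj₂ (sᵢ , sⱼ , distinct₄
            (differ zx zy (inj₂ x≢y)) (differ zx eᵢ (inj₁ (i≢l ∘ sym))) (differ zx eⱼ (inj₁ (j≢l ∘ sym)))
            (differ zy eᵢ (inj₁ (i≢l ∘ sym))) (differ zy eⱼ (inj₁ (j≢l ∘ sym))) (differ eᵢ eⱼ (inj₁ i≢j)))))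
      ... | no z≢i | no z≢j | no z≢l = ⊥-elim (ℕ.<⇒≱ (s≤s k≤4) (distinct-≤ five-colours))
        where
          five-colours : Vec.Unique (col (leaf z) centreX Vec.∷ col (leaf z) centreY Vec.∷
                                     col (leaf i) (centre sᵢ) Vec.∷ col (leaf j) (centre sⱼ) Vec.∷
                                     col (leaf l) (centre sₗ) Vec.∷ Vec.[])
          five-colours = distinct₅
            (colours-differ zx zy (inj₂ x≢y)) (colours-differ zx eᵢ (inj₁ z≢i))
            (colours-differ zx eⱼ (inj₁ z≢j)) (colours-differ zx eₗ (inj₁ z≢l))
            (colours-differ zy eᵢ (inj₁ z≢i)) (colours-differ zy eⱼ (inj₁ z≢j))
            (colours-differ zy eₗ (inj₁ z≢l)) (colours-differ eᵢ eⱼ (inj₁ i≢j))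
            (colours-differ eᵢ eₗ (inj₁ i≢l)) (colours-differ eⱼ eₗ (inj₁ j≢l))

      compatible : Compatible (profile i) (profile j) (profile l)
      compatible with sᵢ Fin.≟ sⱼ | sᵢ Fin.≟ sₗ
      ... | yes refl | yes refl = inj₁ (sᵢ , distinct₃
            (differ eᵢ eⱼ (inj₁ i≢j)) (differ eᵢ eₗ (inj₁ i≢l)) (differ eⱼ eₗ (inj₁ j≢l)))
      ... | no sᵢ≢sⱼ | _ = let (z , zx , zy) = hub-leaf sᵢ≢sⱼ eᵢ eⱼ in through-hub z zx zy
      ... | yes refl | no sᵢ≢sₗ = let (z , zx , zy) = hub-leaf sᵢ≢sₗ eᵢ eₗ in through-hub z zx zy

  tree-compatible : k ≤ 4 → ∀ {i j l} → i ≢ j → i ≢ l → j ≢ l →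
                    RainbowTreeFor (K2 t) c (leaf i) (leaf j) (leaf l) →
                    Compatible (profile i) (profile j) (profile l)
  tree-compatible k≤4 i≢j i≢l j≢l (H , tree , rainbow , wᵢ , wⱼ , wₗ)
    with _ , eᵢ ← InTree.attached H tree rainbow wᵢ wⱼ (i≢j ∘ leaf-injective)
       | _ , eⱼ ← InTree.attached H tree rainbow wⱼ wᵢ (i≢j ∘ sym ∘ leaf-injective)
       | _ , eₗ ← InTree.attached H tree rainbow wₗ wᵢ (i≢l ∘ sym ∘ leaf-injective)
    = InTree.Triple.compatible H tree rainbow k≤4 i≢j i≢l j≢l eᵢ eⱼ eₗ

InRange : ℕ → Profile → Set
InRange K (a , b) = a < K × b < K

record CompatibleFamily (N K : ℕ) : Set where
  field
    member     : Fin N → Profile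
    in-range   : ∀ i → InRange K (member i)
    compatible : ∀ i j l → i ≢ j → i ≢ l → j ≢ l → Compatible (member i) (member j) (member l)

colouring-family : ∀ {N K t k} → k ≤ 4 → k ≤ K → N ≤ t →
                   3RainbowColorable (K2 t) k → CompatibleFamily N K
colouring-family {N} {K} {t} {k} k≤4 k≤K N≤t (c , rainbow-trees) = record
  { member = profile ∘ embed
  ; in-range = λ i → bounded (col (leaf (embed i)) centreX) , bounded (col (leaf (embed i)) centreY)
  ; compatible = λ i j l i≢j i≢l j≢l →
      tree-compatible k≤4 (embed-apart i≢j) (embed-apart i≢l) (embed-apart j≢l)
        (rainbow-trees _ _ _ (leaf-apart i≢j) (leaf-apart i≢l) (leaf-apart j≢l))
  }
  where
    open LeafProfiles c
    open EdgeColoring c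
    embed : Fin N → Fin t
    embed i = inject≤ i N≤t
    embed-apart : ∀ {i j} → i ≢ j → embed i ≢ embed j
    embed-apart i≢j eq = i≢j (Fin.inject≤-injective N≤t N≤t _ _ eq)
    leaf-apart : ∀ {i j} → i ≢ j → leaf (embed i) ≢ leaf (embed j)
    leaf-apart i≢j = embed-apart i≢j ∘ leaf-injective
    bounded : (a : Fin k) → toℕ a < K
    bounded a = ℕ.≤-trans (Fin.toℕ<n a) k≤K

indicator : ∀ {A : Set} → Dec A → ℕ
indicator (yes _) = 1
indicator (no _) = 0

length-filter-∷ : ∀ {A : Set} {P : A → Set} (P? : Decidable P) x xs →
                  length (filter P? (x ∷ xs)) ≡ indicator (P? x) + length (filter P? xs)
length-filter-∷ P? x xs with P? x
... | yes _ = refl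
... | no _ = refl

sum-map-+ : ∀ {A : Set} (g h : A → ℕ) xs → sum (map (λ x → g x + h x) xs) ≡ sum (map g xs) + sum (map h xs)
sum-map-+ g h [] = refl
sum-map-+ g h (x ∷ xs) = trans (cong (g x + h x +_) (sum-map-+ g h xs)) (interchange (g x) (h x) _ _)

sum-map-0 : ∀ {A : Set} (xs : List A) → sum (map (λ _ → 0) xs) ≡ 0
sum-map-0 [] = refl
sum-map-0 (_ ∷ xs) = sum-map-0 xs

module Counting {B : Set} (_≟_ : DecidableEquality B) where

  occurrences : B → List B → ℕ
  occurrences b ts = sum (map (λ t → indicator (b ≟ t)) ts)

  fibres-partition : ∀ {A : Set} (f : A → B) ts → (∀ x → occurrences (f x) ts ≡ 1) →
                     ∀ xs → sum (map (λ t → length (filter (λ x → f x ≟ t) xs)) ts) ≡ length xs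
  fibres-partition f ts once [] = sum-map-0 ts
  fibres-partition f ts once (x ∷ xs) = begin
    sum (map (λ t → length (filter (λ y → f y ≟ t) (x ∷ xs))) ts)
      ≡⟨ cong sum (map-cong (λ t → length-filter-∷ (λ y → f y ≟ t) x xs) ts) ⟩
    sum (map (λ t → indicator (f x ≟ t) + length (filter (λ y → f y ≟ t) xs)) ts)
      ≡⟨ sum-map-+ _ _ ts ⟩
    occurrences (f x) ts + sum (map (λ t → length (filter (λ y → f y ≟ t) xs)) ts)
      ≡⟨ cong₂ _+_ (once x) (fibres-partition f ts once xs) ⟩
    suc (length xs) ∎
    where open ≡-Reasoning

open Counting _≟ₚ_ using (occurrences; fibres-partition)

-- Boolean tests used by the search.  Only one direction of their correctness
-- is needed: every true instance is detected.
∧-split : ∀ a {b} → T (a ∧ b) → T a × T b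
∧-split a = Equivalence.to (T-∧ {a})

∨-injˡ : ∀ {a b} → T a → T (a ∨ b)
∨-injˡ p = Equivalence.from T-∨ (inj₁ p)

∨-injʳ : ∀ a {b} → T b → T (a ∨ b)
∨-injʳ a p = Equivalence.from (T-∨ {a}) (inj₂ p)

when : ∀ a {b} → T (not a ∨ b) → T a → T b
when true ok _ = ok

allᵇ : ∀ {A : Set} → (A → Bool) → List A → Bool
allᵇ p [] = true
allᵇ p (x ∷ xs) = p x ∧ allᵇ p xs

allᵇ-complete : ∀ {A : Set} {p : A → Bool} {xs} → All (T ∘ p) xs → T (allᵇ p xs)
allᵇ-complete [] = tt
allᵇ-complete (px ∷ pxs) = Equivalence.from T-∧ (px , allᵇ-complete pxs)

allPairsᵇ : ∀ {A : Set} → (A → A → Bool) → List A → Bool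
allPairsᵇ r [] = true
allPairsᵇ r (x ∷ xs) = allᵇ (r x) xs ∧ allPairsᵇ r xs

allPairsᵇ-complete : ∀ {A : Set} {r : A → A → Bool} {xs} → AllPairs (λ a b → T (r a b)) xs → T (allPairsᵇ r xs)
allPairsᵇ-complete [] = tt
allPairsᵇ-complete (px ∷ pxs) = Equivalence.from T-∧ (allᵇ-complete px , allPairsᵇ-complete pxs)

T-not : ∀ {a} → ¬ T a → T (not a)
T-not {true} ¬a = ¬a tt
T-not {false} _ = tt

T-not-elim : ∀ {a} → T (not a) → ¬ T a
T-not-elim {true} ()

distinctᵇ : List ℕ → Bool
distinctᵇ = allPairsᵇ λ a b → not (a ≡ᵇ b)

distinctᵇ-complete : ∀ {xs} → Unique xs → T (distinctᵇ xs)
distinctᵇ-complete u = allPairsᵇ-complete (AllPairs.map (λ a≢b → T-not (a≢b ∘ ℕ.≡ᵇ⇒≡ _ _)) u)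

-- The star and hub conditions, with the choice of centres unfolded.
starᵇ hubᵇ : Profile → Profile → Profile → Bool
starᵇ (a , b) (c , d) (e , f) = distinctᵇ (a ∷ c ∷ e ∷ []) ∨ distinctᵇ (b ∷ d ∷ f ∷ [])
hubᵇ (a , b) (c , c′) (d , d′) =
  distinctᵇ (a ∷ b ∷ c ∷ d ∷ []) ∨ distinctᵇ (a ∷ b ∷ c ∷ d′ ∷ []) ∨
  distinctᵇ (a ∷ b ∷ c′ ∷ d ∷ []) ∨ distinctᵇ (a ∷ b ∷ c′ ∷ d′ ∷ [])

starᵇ-complete : ∀ {p q r} s → Unique (colourAt s p ∷ colourAt s q ∷ colourAt s r ∷ []) → T (starᵇ p q r)
starᵇ-complete fzero u = ∨-injˡ (distinctᵇ-complete u)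
starᵇ-complete {p} {q} {r} (fsuc fzero) u = ∨-injʳ (distinctᵇ (proj₁ p ∷ proj₁ q ∷ proj₁ r ∷ [])) (distinctᵇ-complete u)

hubᵇ-complete : ∀ {p q r} → Hub p q r → T (hubᵇ p q r)
hubᵇ-complete (fzero , fzero , u) = ∨-injˡ (distinctᵇ-complete u)
hubᵇ-complete {a , b} {c , c′} {d , d′} (fzero , fsuc fzero , u) =
  ∨-injʳ (distinctᵇ (a ∷ b ∷ c ∷ d ∷ [])) (∨-injˡ (distinctᵇ-complete u))
hubᵇ-complete {a , b} {c , c′} {d , d′} (fsuc fzero , fzero , u) =
  ∨-injʳ (distinctᵇ (a ∷ b ∷ c ∷ d ∷ [])) (∨-injʳ (distinctᵇ (a ∷ b ∷ c ∷ d′ ∷ [])) (∨-injˡ (distinctᵇ-complete u)))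
hubᵇ-complete {a , b} {c , c′} {d , d′} (fsuc fzero , fsuc fzero , u) =
  ∨-injʳ (distinctᵇ (a ∷ b ∷ c ∷ d ∷ [])) (∨-injʳ (distinctᵇ (a ∷ b ∷ c ∷ d′ ∷ []))
    (∨-injʳ (distinctᵇ (a ∷ b ∷ c′ ∷ d ∷ [])) (distinctᵇ-complete u)))

compatibleᵇ : Profile → Profile → Profile → Bool
compatibleᵇ p q r = starᵇ p q r ∨ hubᵇ p q r ∨ hubᵇ q p r ∨ hubᵇ r p q

compatibleᵇ-complete : ∀ {p q r} → Compatible p q r → T (compatibleᵇ p q r)
compatibleᵇ-complete (inj₁ (s , u)) = ∨-injˡ (starᵇ-complete s u)
compatibleᵇ-complete {p} {q} {r} (inj₂ (inj₁ h)) = ∨-injʳ (starᵇ p q r) (∨-injˡ (hubᵇ-complete h))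
compatibleᵇ-complete {p} {q} {r} (inj₂ (inj₂ (inj₁ h))) =
  ∨-injʳ (starᵇ p q r) (∨-injʳ (hubᵇ p q r) (∨-injˡ (hubᵇ-complete h)))
compatibleᵇ-complete {p} {q} {r} (inj₂ (inj₂ (inj₂ h))) =
  ∨-injʳ (starᵇ p q r) (∨-injʳ (hubᵇ p q r) (∨-injʳ (hubᵇ q p r) (hubᵇ-complete h)))

sameᵇ : Profile → Profile → Bool
sameᵇ (a , b) (c , d) = (a ≡ᵇ c) ∧ (b ≡ᵇ d)

memberᵇ : Profile → List Profile → Bool
memberᵇ t = any (sameᵇ t)

memberᵇ-complete : ∀ {t M} → t ∈ M → T (memberᵇ t M)
memberᵇ-complete {t} t∈M = any⁺ (sameᵇ t) (Any.map (λ { refl → sameᵇ-refl t }) t∈M)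
  where
    sameᵇ-refl : ∀ p → T (sameᵇ p p)
    sameᵇ-refl (a , b) = Equivalence.from T-∧ (ℕ.≡⇒≡ᵇ a a refl , ℕ.≡⇒≡ᵇ b b refl)

-- An exhaustive search over multisets of profiles.  The profiles in ts are
-- considered in turn and M is the multiset placed so far.  A profile is used
-- at most twice, since no profile is compatible with itself thrice, and is
-- added only if every new triple stays compatible.  `Refuted ts M` says that
-- no such extension of M reaches exactly N profiles; it also records that each
-- t is new and not triply compatible, which its soundness proof relies on.
module Search (N : ℕ) where

  AddableOnce AddableTwice : Profile → List Profile → Set
  AddableOnce t M = AllPairs (Compatible t) M
  AddableTwice t M = AddableOnce t M × All (Compatible t t) M

  Refuted : List Profile → List Profile → Set
  Refuted [] M = length M ≢ N
  Refuted (t ∷ ts) M =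
    t ∉ M × ¬ Compatible t t t × Refuted ts M ×
    (AddableOnce t M → Refuted ts (t ∷ M)) × (AddableTwice t M → Refuted ts (t ∷ t ∷ M))

  onceᵇ twiceᵇ : Profile → List Profile → Bool
  onceᵇ t M = allPairsᵇ (compatibleᵇ t) M
  twiceᵇ t M = onceᵇ t M ∧ allᵇ (compatibleᵇ t t) M

  refutedᵇ : List Profile → List Profile → Bool
  refutedᵇ [] M = not (length M ≡ᵇ N)
  refutedᵇ (t ∷ ts) M =
    not (memberᵇ t M) ∧ not (compatibleᵇ t t t) ∧ refutedᵇ ts M ∧
    (not (onceᵇ t M) ∨ refutedᵇ ts (t ∷ M)) ∧ (not (twiceᵇ t M) ∨ refutedᵇ ts (t ∷ t ∷ M))

  refuted-by-search : ∀ ts M → T (refutedᵇ ts M) → Refuted ts M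
  refuted-by-search [] M ok eq = T-not-elim ok (ℕ.≡⇒≡ᵇ _ N eq)
  refuted-by-search (t ∷ ts) M ok =
    let fresh , ok₁ = ∧-split (not (memberᵇ t M)) ok
        no-triple , ok₂ = ∧-split (not (compatibleᵇ t t t)) ok₁
        skip , ok₃ = ∧-split (refutedᵇ ts M) ok₂
        once , twice = ∧-split (not (onceᵇ t M) ∨ refutedᵇ ts (t ∷ M)) ok₃
    in (λ t∈M → T-not-elim fresh (memberᵇ-complete t∈M)) ,
       (λ c → T-not-elim no-triple (compatibleᵇ-complete c)) ,
       refuted-by-search ts M skip ,
       (λ pairs → refuted-by-search ts (t ∷ M) (when (onceᵇ t M) once (once-complete pairs))) ,
       (λ two → refuted-by-search ts (t ∷ t ∷ M) (when (twiceᵇ t M) twice (twice-complete two)))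
    where
      once-complete : AddableOnce t M → T (onceᵇ t M)
      once-complete pairs = allPairsᵇ-complete (AllPairs.map compatibleᵇ-complete pairs)
      twice-complete : AddableTwice t M → T (twiceᵇ t M)
      twice-complete (pairs , singles) =
        Equivalence.from T-∧ (once-complete pairs , allᵇ-complete (All.map compatibleᵇ-complete singles))

  module _ {f : Fin N → Profile}
           (compat : ∀ i j l → i ≢ j → i ≢ l → j ≢ l → Compatible (f i) (f j) (f l)) where

    fibre : Profile → List (Fin N)
    fibre t = filter (λ i → f i ≟ₚ t) (allFin N)

    Size : List Profile → ℕ
    Size ts = sum (map (λ t → length (fibre t)) ts)

    fresh-index : ∀ {i L} → f i ∉ map f L → All (i ≢_) L
    fresh-index fi∉ = All.tabulate λ { j∈L refl → fi∉ (∈-map⁺ f j∈L) }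

    compatible-pairs : ∀ {i L} → All (i ≢_) L → Unique L → AllPairs (λ a b → Compatible (f i) (f a) (f b)) L
    compatible-pairs [] [] = []
    compatible-pairs (i≢a ∷ i∉) (a∉ ∷ u) =
      All.zipWith (λ (i≢b , a≢b) → compat _ _ _ i≢a i≢b a≢b) (i∉ , a∉) ∷ compatible-pairs i∉ u

    compatible-singles : ∀ {i j L} → i ≢ j → All (i ≢_) L → All (j ≢_) L → All (Compatible (f i) (f j)) (map f L)
    compatible-singles i≢j i∉ j∉ = map⁺ (All.zipWith (λ (i≢a , j≢a) → compat _ _ _ i≢j i≢a j≢a) (i∉ , j∉))

    -- Invariant: L lists the distinct indices placed so far, and the indices
    -- with profiles in ts account for the rest.
    refuted-sound : ∀ ts L → Unique L → length L + Size ts ≡ N → ¬ Refuted ts (map f L)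
    place : ∀ {t ts L} → Unique L → Refuted (t ∷ ts) (map f L) →
            ∀ is → Unique is → All (λ i → f i ≡ t) is → length L + (length is + Size ts) ≡ N → ⊥

    refuted-sound [] L _ size r = r (trans (length-map f L) (trans (sym (ℕ.+-identityʳ _)) size))
    refuted-sound (t ∷ ts) L u size r =
      place u r (fibre t) (filter⁺ (λ i → f i ≟ₚ t) (allFin⁺ N)) (all-filter (λ i → f i ≟ₚ t) (allFin N)) size

    place u (_ , _ , skip , _ , _) [] _ _ size = refuted-sound _ _ u size skip
    place {L = L} u (fresh , _ , _ , once , _) (i ∷ []) _ (refl ∷ []) size =
      refuted-sound _ (i ∷ L) (i∉ ∷ u) (trans (sym (ℕ.+-suc _ _)) size)
        (once (pairs-map⁺ (compatible-pairs i∉ u)))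
      where
        i∉ : All (i ≢_) L
        i∉ = fresh-index fresh
    place {ts = ts} {L} u (fresh , _ , _ , _ , twice) (i ∷ j ∷ []) ((i≢j ∷ []) ∷ _) (refl ∷ fj≡fi ∷ []) size =
      refuted-sound _ (i ∷ j ∷ L) ((i≢j ∷ i∉) ∷ j∉ ∷ u)
        (trans (sym (trans (ℕ.+-suc _ _) (cong suc (ℕ.+-suc _ _)))) size)
        (subst (λ p → Refuted ts (f i ∷ p ∷ map f L)) (sym fj≡fi)
          (twice (pairs-map⁺ (compatible-pairs i∉ u) ,
                  subst (λ p → All (Compatible (f i) p) (map f L)) fj≡fi (compatible-singles i≢j i∉ j∉))))
      where
        i∉ : All (i ≢_) L
        i∉ = fresh-index fresh
        j∉ : All (j ≢_) L
        j∉ = fresh-index (subst (_∉ map f L) (sym fj≡fi) fresh)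
    place u (_ , no-triple , _) (i ∷ j ∷ l ∷ _) ((i≢j ∷ i≢l ∷ _) ∷ (j≢l ∷ _) ∷ _) (refl ∷ fj≡fi ∷ fl≡fi ∷ _) _ =
      no-triple (subst₂ (Compatible (f i)) fj≡fi fl≡fi (compat i j l i≢j i≢l j≢l))

  no-family : ∀ {K} ts → (∀ p → InRange K p → occurrences p ts ≡ 1) → Refuted ts [] → ¬ CompatibleFamily N K
  no-family ts exactly-once r family =
    refuted-sound compatible ts [] [] size r
    where
      open CompatibleFamily family
      size : Size compatible ts ≡ N
      size = trans (fibres-partition member ts (λ i → exactly-once _ (in-range i)) (allFin N)) (length-tabulate id)

profiles : ℕ → List Profile
profiles K = cartesianProduct (upTo K) (upTo K)

ListsOnce : ℕ → Set
ListsOnce K = ∀ (a b : Fin K) → occurrences (toℕ a , toℕ b) (profiles K) ≡ 1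

listsOnce? : ∀ K → Dec (ListsOnce K)
listsOnce? K = Fin.all? λ a → Fin.all? λ b → occurrences (toℕ a , toℕ b) (profiles K) ℕ.≟ 1

exactly-once : ∀ {K} → ListsOnce K → ∀ p → InRange K p → occurrences p (profiles K) ≡ 1
exactly-once {K} once (a , b) (a<K , b<K) =
  subst₂ (λ a′ b′ → occurrences (a′ , b′) (profiles K) ≡ 1) (Fin.toℕ-fromℕ< a<K) (Fin.toℕ-fromℕ< b<K)
    (once (fromℕ< a<K) (fromℕ< b<K))

no-family-5-3 : ¬ CompatibleFamily 5 3
no-family-5-3 = Search.no-family 5 (profiles 3) (exactly-once (toWitness {a? = listsOnce? 3} tt))
                  (Search.refuted-by-search 5 (profiles 3) [] tt)

no-family-9-4 : ¬ CompatibleFamily 9 4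
no-family-9-4 = Search.no-family 9 (profiles 4) (exactly-once (toWitness {a? = listsOnce? 4} tt))
                  (Search.refuted-by-search 9 (profiles 4) [] tt)

below-four : ∀ t → 5 ≤ t → ∀ k → k < 4 → ¬ 3RainbowColorable (K2 t) k
below-four t 5≤t k (s≤s k≤3) col = no-family-5-3 (colouring-family (ℕ.m≤n⇒m≤1+n k≤3) k≤3 5≤t col)

at-least-five : ∀ t → 9 ≤ t → rx3≥ (K2 t) 5
at-least-five t 9≤t k col with 5 ℕ.≤? k
... | yes 5≤k = 5≤k
... | no 5≰k = ⊥-elim (no-family-9-4 (colouring-family k≤4 k≤4 9≤t col))
  where
    k≤4 : k ≤ 4
    k≤4 = ℕ.≤-pred (ℕ.≰⇒> 5≰k)

lemma2p4 : (∀ (t : ℕ) → 5 ≤ t → t ≤ 8 → rx3≡ (K2 t) 4)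
         × (∀ (t : ℕ) → 9 ≤ t → rx3≥ (K2 t) 5)
lemma2p4 = (λ t 5≤t t≤8 → four-colourable t 5≤t t≤8 , below-four t 5≤t) , at-least-five
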